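{- Let $L$ be a complete lattice with least element $0$ and greatest element $1$, let $n\geq 1$, and let $f\colon L^n\to L$ be an aggregation function. (a) $f$ preserves arbitrary suprema if and only if there exist a closure system $S\subseteq L^n$, an interior system $T\subseteq L$ with $1\in T$, and an order isomorphism $\varphi\colon S\to T$ such that $f(\mathbf{x})=\varphi(c_S(\mathbf{x}))$ for all $\mathbf{x}\in L^n$, where $c_S$ is the closure operator on $L^n$ corresponding to $S$. (b) $f$ preserves arbitrary infima if and only if there exist an interior system $T\subseteq L^n$, a closure system $S\subseteq L$ with $0\in S$, and an order isomorphism $\varphi\colon T\to S$ such that $f(\mathbf{x})=\varphi(i_T(\mathbf{x}))$ for all $\mathbf{x}\in L^n$, where $i_T$ is the interior operator on $L^n$ corresponding to $T$.
   Context: $L^n$ is ordered componentwise. An aggregation function $f\colon L^n\to L$ is a map that is monotone (if $x_k\leq y_k$ for all $k$ then $f(x_1,\dots,x_n)\leq f(y_1,\dots,y_n)$) and satisfies $f(0,\dots,0)=0$ and $f(1,\dots,1)=1$. For a complete lattice $K$: a closure system on $K$ is a subset $S\subseteq K$ closed under arbitrary infima (so it contains the top element, the infimum of the empty set); its closure operator is $c_S(x)=\bigwedge\{y\in S\mid x\leq y\}$. An interior system on $K$ is a subset $T\subseteq K$ closed under arbitrary suprema (so it contains the bottom element); its interior operator is $i_T(x)=\bigvee\{y\in T\mid y\leq x\}$. "Preserves arbitrary suprema" means $f(\bigvee X)=\bigvee f(X)$ for every subset $X$ (including the empty set), and dually for infima. -}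

module Defs where

open import Level using (Level; _⊔_; Lift) renaming (suc to lsuc)
open import Data.Empty using (⊥)
open import Data.Product using (Σ; ∃; _×_; _,_; proj₁; proj₂)
open import Data.Nat using (ℕ)
open import Data.Fin using (Fin; zero; suc)
open import Data.Vec using (Vec; []; _∷_; lookup; tabulate; replicate)
open import Data.Vec.Properties using (lookup∘tabulate)
open import Relation.Unary using (Pred; _∈_; _⊆_)
open import Relation.Binary using (Rel; IsPartialOrder)
open import Relation.Binary.PropositionalEquality using (_≡_; refl; cong; cong₂; trans; sym)

record CompleteLattice (c ℓ : Level) : Set (lsuc (c ⊔ ℓ)) where
  field
    Carrier        : Set c
    _≤_            : Rel Carrier ℓ
    isPartialOrder : IsPartialOrder _≡_ _≤_
    ⋁              : Pred Carrier (c ⊔ ℓ) → Carrier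
    ⋁-upper        : (X : Pred Carrier (c ⊔ ℓ)) → ∀ x → X x → x ≤ ⋁ X
    ⋁-least        : (X : Pred Carrier (c ⊔ ℓ)) → ∀ u → (∀ x → X x → x ≤ u) → ⋁ X ≤ u
    ⋀              : Pred Carrier (c ⊔ ℓ) → Carrier
    ⋀-lower        : (X : Pred Carrier (c ⊔ ℓ)) → ∀ x → X x → ⋀ X ≤ x
    ⋀-greatest     : (X : Pred Carrier (c ⊔ ℓ)) → ∀ u → (∀ x → X x → u ≤ x) → u ≤ ⋀ X

  open IsPartialOrder isPartialOrder public

  bot : Carrier
  bot = ⋁ (λ _ → Lift (c ⊔ ℓ) ⊥)

  top : Carrier
  top = ⋀ (λ _ → Lift (c ⊔ ℓ) ⊥)

module _ {c ℓ : Level} where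

  image : {A B : Set c} → (A → B) → Pred A (c ⊔ ℓ) → Pred B (c ⊔ ℓ)
  image {A} f X y = Σ A (λ x → X x × f x ≡ y)

  private
    vec-ext : ∀ {A : Set c} {n} (x y : Vec A n) → (∀ k → lookup x k ≡ lookup y k) → x ≡ y
    vec-ext [] [] _ = refl
    vec-ext (a ∷ x) (b ∷ y) e = cong₂ _∷_ (e zero) (vec-ext x y (λ k → e (suc k)))

  _^_ : CompleteLattice c ℓ → ℕ → CompleteLattice c ℓ
  L ^ n = record
    { Carrier = Vec Carrier n
    ; _≤_ = λ x y → ∀ k → lookup x k ≤ lookup y k
    ; isPartialOrder = record
      { isPreorder = record
        { isEquivalence = Relation.Binary.PropositionalEquality.isEquivalence
        ; reflexive = λ { refl k → refl' }
        ; trans = λ p q k → trans' (p k) (q k)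
        }
      ; antisym = λ p q → vec-ext _ _ (λ k → antisym (p k) (q k))
      }
    ; ⋁ = λ X → tabulate (λ k → ⋁ (comp X k))
    ; ⋁-upper = λ X x Xx k → subst≤ʳ (lookup∘tabulate (λ j → ⋁ (comp X j)) k) (⋁-upper (comp X k) _ (x , Xx , refl))
    ; ⋁-least = λ X u h k → subst≤ˡ (lookup∘tabulate (λ j → ⋁ (comp X j)) k)
          (⋁-least (comp X k) _ (λ { a (x , Xx , refl) → h x Xx k }))
    ; ⋀ = λ X → tabulate (λ k → ⋀ (comp X k))
    ; ⋀-lower = λ X x Xx k → subst≤ˡ (lookup∘tabulate (λ j → ⋀ (comp X j)) k) (⋀-lower (comp X k) _ (x , Xx , refl))
    ; ⋀-greatest = λ X u h k → subst≤ʳ (lookup∘tabulate (λ j → ⋀ (comp X j)) k)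
          (⋀-greatest (comp X k) _ (λ { a (x , Xx , refl) → h x Xx k }))
    }
    where
      open CompleteLattice L hiding (refl; trans; reflexive; isEquivalence)
      refl' : ∀ {a} → a ≤ a
      refl' = IsPartialOrder.refl isPartialOrder
      trans' : ∀ {a b d} → a ≤ b → b ≤ d → a ≤ d
      trans' = IsPartialOrder.trans isPartialOrder
      comp : Pred (Vec Carrier n) (c ⊔ ℓ) → Fin n → Pred Carrier (c ⊔ ℓ)
      comp X k a = Σ (Vec Carrier n) (λ x → X x × lookup x k ≡ a)
      subst≤ˡ : ∀ {a b d} → a ≡ b → b ≤ d → a ≤ d
      subst≤ˡ refl p = p
      subst≤ʳ : ∀ {a b d} → b ≡ d → a ≤ d → a ≤ b
      subst≤ʳ refl p = p

module _ {c ℓ : Level} (K : CompleteLattice c ℓ) where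
  open CompleteLattice K hiding (refl; trans)

  IsClosureSystem : Pred Carrier (c ⊔ ℓ) → Set (lsuc (c ⊔ ℓ))
  IsClosureSystem S = (X : Pred Carrier (c ⊔ ℓ)) → X ⊆ S → S (⋀ X)

  IsInteriorSystem : Pred Carrier (c ⊔ ℓ) → Set (lsuc (c ⊔ ℓ))
  IsInteriorSystem T = (X : Pred Carrier (c ⊔ ℓ)) → X ⊆ T → T (⋁ X)

  closureOp : Pred Carrier (c ⊔ ℓ) → Carrier → Carrier
  closureOp S x = ⋀ (λ y → S y × x ≤ y)

  interiorOp : Pred Carrier (c ⊔ ℓ) → Carrier → Carrier
  interiorOp T x = ⋁ (λ y → T y × y ≤ x)

  PreservesSups : (K' : CompleteLattice c ℓ) → (Carrier → CompleteLattice.Carrier K') → Set (lsuc (c ⊔ ℓ))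
  PreservesSups K' f = (X : Pred Carrier (c ⊔ ℓ)) → f (⋁ X) ≡ CompleteLattice.⋁ K' (image {c} {ℓ} f X)

  PreservesInfs : (K' : CompleteLattice c ℓ) → (Carrier → CompleteLattice.Carrier K') → Set (lsuc (c ⊔ ℓ))
  PreservesInfs K' f = (X : Pred Carrier (c ⊔ ℓ)) → f (⋀ X) ≡ CompleteLattice.⋀ K' (image {c} {ℓ} f X)

-- An order isomorphism φ : S → T between subsets S ⊆ K and T ⊆ K'
-- (each with the induced order): a map from S into T that is surjective
-- onto T and satisfies  s ≤ s'  ⇔  φ s ≤ φ s'  (hence is also injective).
record OrderIso {c ℓ : Level} (K K' : CompleteLattice c ℓ)
                (S : Pred (CompleteLattice.Carrier K) (c ⊔ ℓ))
                (T : Pred (CompleteLattice.Carrier K') (c ⊔ ℓ)) : Set (c ⊔ ℓ) where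
  private
    module K = CompleteLattice K
    module K' = CompleteLattice K'
  field
    φ         : Σ K.Carrier S → K'.Carrier
    into      : ∀ s → T (φ s)
    onto      : ∀ t → T t → Σ (Σ K.Carrier S) (λ s → φ s ≡ t)
    monotone  : ∀ s s' → proj₁ s K.≤ proj₁ s' → φ s K'.≤ φ s'
    reflects  : ∀ s s' → φ s K'.≤ φ s' → proj₁ s K.≤ proj₁ s'

module _ {c ℓ : Level} (L : CompleteLattice c ℓ) (n : ℕ) where
  open CompleteLattice L hiding (refl; trans)

  record IsAggregation (f : Vec Carrier n → Carrier) : Set (c ⊔ ℓ) where
    field
      monotone : ∀ x y → (∀ k → lookup x k ≤ lookup y k) → f x ≤ f y
      f-bot    : f (replicate n bot) ≡ bot
      f-top    : f (replicate n top) ≡ top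

  SupRepresentation : (Vec Carrier n → Carrier) → Set (lsuc (c ⊔ ℓ))
  SupRepresentation f =
    Σ (Pred (Vec Carrier n) (c ⊔ ℓ)) λ S →
    Σ (IsClosureSystem (L ^ n) S) λ S-closed →
    Σ (Pred Carrier (c ⊔ ℓ)) λ T →
    IsInteriorSystem L T × top ∈ T ×
    Σ (OrderIso (L ^ n) L S T) λ iso →
      ∀ x → f x ≡ OrderIso.φ iso
                    ( closureOp (L ^ n) S x
                    , S-closed _ proj₁ )

  InfRepresentation : (Vec Carrier n → Carrier) → Set (lsuc (c ⊔ ℓ))
  InfRepresentation f =
    Σ (Pred (Vec Carrier n) (c ⊔ ℓ)) λ T →
    Σ (IsInteriorSystem (L ^ n) T) λ T-closed →
    Σ (Pred Carrier (c ⊔ ℓ)) λ S →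
    IsClosureSystem L S × bot ∈ S ×
    Σ (OrderIso (L ^ n) L T S) λ iso →
      ∀ x → f x ≡ OrderIso.φ iso
                    ( interiorOp (L ^ n) T x
                    , T-closed _ proj₁ )

module Submission where

open import Defs
open import Level using (Level; Lift; lift; _⊔_) renaming (suc to lsuc)
open import Data.Product using (_×_; Σ; _,_; proj₁; proj₂)
open import Data.Nat using (ℕ; _≤_)
open import Data.Vec using (Vec; replicate)
open import Function using (flip)
open import Function.Bundles using (_⇔_; mk⇔; Equivalence)
open import Relation.Unary using (Pred; _∈_)
open import Relation.Binary.PropositionalEquality as ≡ using (_≡_; subst)

-- A sup-preserving monotone f : K → K' has an upper adjoint (residual) g. The closure
-- system is the set of fixed points of g ∘ f, the interior system is the image
-- of f, and f restricts to an order isomorphism between them; f = f ∘ c_S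
-- because c_S x = g (f x). Conversely, if f = φ ∘ c_S, then ⋁ f[X] lies in the
-- interior system, so it is φ s for some closed s above every x ∈ X, whence
-- f (⋁ X) ≤ φ s. The statement about infima is the dual one, obtained by
-- reversing the orders of both lattices.

module _ {c ℓ : Level} (K : CompleteLattice c ℓ) where
  private
    module K = CompleteLattice K

  ≤-top : ∀ x → x K.≤ K.top
  ≤-top x = K.⋀-greatest _ x (λ { _ (lift ()) })

  bot-≤ : ∀ x → K.bot K.≤ x
  bot-≤ x = K.⋁-least _ x (λ { _ (lift ()) })

  closure-extensive : ∀ S x → x K.≤ closureOp K S x
  closure-extensive S x = K.⋀-greatest _ x (λ _ → proj₂)

  closure-least : ∀ S {x y} → S y → x K.≤ y → closureOp K S x K.≤ y
  closure-least S Sy x≤y = K.⋀-lower _ _ (Sy , x≤y)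

  opposite : CompleteLattice c ℓ
  opposite = record
    { Carrier = K.Carrier
    ; _≤_ = flip K._≤_
    ; isPartialOrder = record
      { isPreorder = record
        { isEquivalence = ≡.isEquivalence
        ; reflexive = λ e → K.reflexive (≡.sym e)
        ; trans = flip K.trans
        }
      ; antisym = flip K.antisym
      }
    ; ⋁ = K.⋀ ; ⋁-upper = K.⋀-lower ; ⋁-least = K.⋀-greatest
    ; ⋀ = K.⋁ ; ⋀-lower = K.⋁-upper ; ⋀-greatest = K.⋁-least
    }

module _ {c ℓ : Level} {K K' : CompleteLattice c ℓ}
         {S : Pred (CompleteLattice.Carrier K) (c ⊔ ℓ)} {T : Pred (CompleteLattice.Carrier K') (c ⊔ ℓ)} where

  OrderIso-opposite : OrderIso K K' S T → OrderIso (opposite K) (opposite K') S T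
  OrderIso-opposite iso = record
    { φ = φ ; into = into ; onto = onto
    ; monotone = flip monotone ; reflects = flip reflects }
    where open OrderIso iso

  OrderIso-unopposite : OrderIso (opposite K) (opposite K') S T → OrderIso K K' S T
  OrderIso-unopposite iso = record
    { φ = φ ; into = into ; onto = onto
    ; monotone = flip monotone ; reflects = flip reflects }
    where open OrderIso iso

module _ {c ℓ : Level} (K K' : CompleteLattice c ℓ) where
  private
    module A = CompleteLattice K
    module B = CompleteLattice K'

  Monotone : (A.Carrier → B.Carrier) → Set (c ⊔ ℓ)
  Monotone f = ∀ x y → x A.≤ y → f x B.≤ f y

  ClosureRepresentation : (A.Carrier → B.Carrier) → Set (lsuc (c ⊔ ℓ))
  ClosureRepresentation f =
    Σ (Pred A.Carrier (c ⊔ ℓ)) λ S →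
    Σ (IsClosureSystem K S) λ S-closed →
    Σ (Pred B.Carrier (c ⊔ ℓ)) λ T →
    IsInteriorSystem K' T × B.top ∈ T ×
    Σ (OrderIso K K' S T) λ iso →
      ∀ x → f x ≡ OrderIso.φ iso (closureOp K S x , S-closed _ proj₁)

  InteriorRepresentation : (A.Carrier → B.Carrier) → Set (lsuc (c ⊔ ℓ))
  InteriorRepresentation f =
    Σ (Pred A.Carrier (c ⊔ ℓ)) λ T →
    Σ (IsInteriorSystem K T) λ T-interior →
    Σ (Pred B.Carrier (c ⊔ ℓ)) λ S →
    IsClosureSystem K' S × B.bot ∈ S ×
    Σ (OrderIso K K' T S) λ iso →
      ∀ x → f x ≡ OrderIso.φ iso (interiorOp K T x , T-interior _ proj₁)

  module Residuation {f : A.Carrier → B.Carrier}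
                     (f-mono : Monotone f) (f-⋁ : PreservesSups K K' f) where

    residual : B.Carrier → A.Carrier
    residual y = A.⋁ (λ x → Lift c (f x B.≤ y))

    f-residual≤ : ∀ y → f (residual y) B.≤ y
    f-residual≤ y = B.≤-respˡ-≈ (≡.sym (f-⋁ _))
      (B.⋁-least _ y (λ { _ (_ , lift fx≤y , ≡.refl) → fx≤y }))

    ≤residual-f : ∀ x → x A.≤ residual (f x)
    ≤residual-f x = A.⋁-upper _ x (lift B.refl)

    residual-mono : ∀ y y' → y B.≤ y' → residual y A.≤ residual y'
    residual-mono y y' y≤y' = A.⋁-least _ _
      (λ { x (lift fx≤y) → A.⋁-upper _ x (lift (B.trans fx≤y y≤y')) })

    f-residual-f : ∀ x → f (residual (f x)) ≡ f x
    f-residual-f x = B.antisym (f-residual≤ _) (f-mono _ _ (≤residual-f x))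

    Closed : Pred A.Carrier (c ⊔ ℓ)
    Closed x = Lift ℓ (x ≡ residual (f x))

    residual-f-closed : ∀ x → Closed (residual (f x))
    residual-f-closed x = lift (A.antisym (≤residual-f _) (residual-mono _ _ (f-residual≤ _)))

    Closed-isClosureSystem : IsClosureSystem K Closed
    Closed-isClosureSystem X X⊆Closed = lift (A.antisym (≤residual-f _)
      (A.⋀-greatest X _ λ x Xx →
        A.≤-respʳ-≈ (≡.sym (Lift.lower (X⊆Closed Xx)))
          (residual-mono _ _ (f-mono _ _ (A.⋀-lower X x Xx)))))

    Image : Pred B.Carrier (c ⊔ ℓ)
    Image y = Σ A.Carrier (λ x → Lift ℓ (f x ≡ y))

    -- ⋁ Y = f (⋁ f⁻¹[Y]) because f preserves suprema.
    Image-isInteriorSystem : IsInteriorSystem K' Image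
    Image-isInteriorSystem Y Y⊆Image = A.⋁ preimage , lift (≡.trans (f-⋁ preimage)
      (B.antisym (B.⋁-least _ _ λ { _ (x , Yfx , ≡.refl) → B.⋁-upper Y (f x) Yfx })
                 (B.⋁-least Y _ λ y Yy → ≤⋁image y Yy (Y⊆Image Yy))))
      where
        preimage : Pred A.Carrier (c ⊔ ℓ)
        preimage x = Y (f x)
        ≤⋁image : ∀ y → Y y → Image y → y B.≤ B.⋁ (image {c} {ℓ} f preimage)
        ≤⋁image y Yy (x , lift fx≡y) =
          B.⋁-upper _ y (x , subst Y (≡.sym fx≡y) Yy , fx≡y)

    top∈Image : B.top B.≤ f A.top → B.top ∈ Image
    top∈Image top≤f-top = A.top , lift (B.antisym (≤-top K' _) top≤f-top)

    Closed≅Image : OrderIso K K' Closed Image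
    Closed≅Image = record
      { φ = λ s → f (proj₁ s)
      ; into = λ s → proj₁ s , lift ≡.refl
      ; onto = λ { y (x , lift fx≡y) →
          (residual (f x) , residual-f-closed x) , ≡.trans (f-residual-f x) fx≡y }
      ; monotone = λ s s' → f-mono _ _
      ; reflects = λ { (s , _) (s' , lift s'≡) fs≤fs' →
          A.trans (≤residual-f s) (A.≤-respʳ-≈ (≡.sym s'≡) (residual-mono _ _ fs≤fs')) }
      }

    f≡f∘closure : ∀ x → f x ≡ f (closureOp K Closed x)
    f≡f∘closure x = B.antisym
      (f-mono _ _ (closure-extensive K Closed x))
      (B.≤-respʳ-≈ (f-residual-f x)
        (f-mono _ _ (closure-least K Closed (residual-f-closed x) (≤residual-f x))))

  preservesSups⇒closureRepresentation : ∀ {f} → Monotone f → B.top B.≤ f A.top →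
    PreservesSups K K' f → ClosureRepresentation f
  preservesSups⇒closureRepresentation f-mono top≤f-top f-⋁ =
    Closed , Closed-isClosureSystem , Image , Image-isInteriorSystem ,
    top∈Image top≤f-top , Closed≅Image , f≡f∘closure
    where open Residuation f-mono f-⋁

  closureRepresentation⇒preservesSups : ∀ {f} → Monotone f →
    ClosureRepresentation f → PreservesSups K K' f
  closureRepresentation⇒preservesSups {f} f-mono (S , S-closed , T , T-interior , _ , iso , f≡φ∘c) X =
    B.antisym f⋁X≤u (B.⋁-least _ _ λ { _ (x , Xx , ≡.refl) → f-mono _ _ (A.⋁-upper X x Xx) })
    where
      open OrderIso iso
      u : B.Carrier
      u = B.⋁ (image {c} {ℓ} f X)
      cl : A.Carrier → Σ A.Carrier S
      cl x = closureOp K S x , S-closed _ proj₁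
      u∈T : T u
      u∈T = T-interior _ λ { (x , _ , ≡.refl) → subst T (≡.sym (f≡φ∘c x)) (into (cl x)) }
      s : Σ A.Carrier S
      s = proj₁ (onto u u∈T)
      φs≡u : φ s ≡ u
      φs≡u = proj₂ (onto u u∈T)
      X≤s : ∀ x → X x → x A.≤ proj₁ s
      X≤s x Xx = A.trans (closure-extensive K S x) (reflects (cl x) s
        (B.≤-respʳ-≈ (≡.sym φs≡u) (B.≤-respˡ-≈ (f≡φ∘c x) (B.⋁-upper _ (f x) (x , Xx , ≡.refl)))))
      f⋁X≤u : f (A.⋁ X) B.≤ u
      f⋁X≤u = B.≤-respˡ-≈ (≡.sym (f≡φ∘c _)) (B.≤-respʳ-≈ φs≡u
        (monotone (cl (A.⋁ X)) s (closure-least K S (proj₂ s) (A.⋁-least X _ X≤s))))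

  preservesSups⇔closureRepresentation : ∀ {f} → Monotone f → B.top B.≤ f A.top →
    PreservesSups K K' f ⇔ ClosureRepresentation f
  preservesSups⇔closureRepresentation f-mono top≤f-top = mk⇔
    (preservesSups⇒closureRepresentation f-mono top≤f-top)
    (closureRepresentation⇒preservesSups f-mono)

module _ {c ℓ : Level} (K K' : CompleteLattice c ℓ) where
  private
    module A = CompleteLattice K
    module B = CompleteLattice K'

  preservesInfs⇔interiorRepresentation : ∀ {f} → Monotone K K' f → f A.bot B.≤ B.bot →
    PreservesInfs K K' f ⇔ InteriorRepresentation K K' f
  preservesInfs⇔interiorRepresentation f-mono f-bot≤bot = mk⇔
    (λ f-⋀ → fromDual (to f-⋀)) (λ rep → from (toDual rep))
    where
      open Equivalence (preservesSups⇔closureRepresentation (opposite K) (opposite K')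
                          (flip f-mono) f-bot≤bot)
      fromDual : ∀ {f} → ClosureRepresentation (opposite K) (opposite K') f → InteriorRepresentation K K' f
      fromDual (T , T-int , S , S-cl , bot∈S , iso , eq) =
        T , T-int , S , S-cl , bot∈S , OrderIso-unopposite iso , eq
      toDual : ∀ {f} → InteriorRepresentation K K' f → ClosureRepresentation (opposite K) (opposite K') f
      toDual (T , T-int , S , S-cl , bot∈S , iso , eq) =
        T , T-int , S , S-cl , bot∈S , OrderIso-opposite iso , eq

module _ {c ℓ : Level} (L : CompleteLattice c ℓ) (n : ℕ) {f} (agg : IsAggregation L n f) where
  private
    module L = CompleteLattice L
    module Lⁿ = CompleteLattice (L ^ n)
  open IsAggregation agg

  aggregation-top : L.top L.≤ f Lⁿ.top
  aggregation-top = L.≤-respˡ-≈ f-top (monotone _ _ (≤-top (L ^ n) (replicate n L.top)))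

  aggregation-bot : f Lⁿ.bot L.≤ L.bot
  aggregation-bot = L.≤-respʳ-≈ f-bot (monotone _ _ (bot-≤ (L ^ n) (replicate n L.bot)))

lemma1 : {c ℓ : Level} (L : CompleteLattice c ℓ) (n : ℕ) → 1 ≤ n →
         (f : Vec (CompleteLattice.Carrier L) n → CompleteLattice.Carrier L) →
         IsAggregation L n f →
         (PreservesSups (L ^ n) L f ⇔ SupRepresentation L n f)
         × (PreservesInfs (L ^ n) L f ⇔ InfRepresentation L n f)
lemma1 L n _ f agg =
    preservesSups⇔closureRepresentation (L ^ n) L monotone (aggregation-top L n agg)
  , preservesInfs⇔interiorRepresentation (L ^ n) L monotone (aggregation-bot L n agg)
  where open IsAggregation agg
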